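{- Fix an integer $b>4$ and let $u$ be an internal node in a B-slack tree with maximum degree $b$. If the total slack contained in the children of $u$ is less than $b$, then some child of $u$ has degree at least three.
   Context: Leaf-oriented search trees store keys in leaves; the degree of an internal node is its number of non-nil child pointers and the degree of a leaf is its number of keys; a node of degree $b-x$ contains $x$ units of slack. A B-slack tree with maximum degree $b$ is a leaf-oriented search tree in which all leaves have the same depth, every internal node has between $2$ and $b$ child pointers, every leaf has between $0$ and $b$ keys, and for every internal node the total slack of its children is at most $b-1$. -}

module Defs where

open import Data.Nat using (ℕ; zero; suc; _+_; _∸_; _≤_; _<_)
open import Data.List using (List; []; _∷_; length)
open import Data.List.Relation.Unary.All using (All)
open import Data.Maybe using (Maybe; just; nothing)
open import Data.Product using (_×_)
open import Data.Unit using (⊤)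
open import Data.Empty using (⊥)
open import Relation.Binary.PropositionalEquality using (_≡_)

-- Leaf-oriented search trees over ℕ keys.
-- A leaf stores its list of keys; an internal node stores its list of
-- routing keys and its list of (non-nil) child pointers.
data Tree : Set where
  leaf : (keys : List ℕ) → Tree
  node : (routing : List ℕ) → (children : List Tree) → Tree

degree : Tree → ℕ
degree (leaf ks)   = length ks
degree (node _ cs) = length cs

slack : ℕ → Tree → ℕ
slack b t = b ∸ degree t

totalSlack : ℕ → List Tree → ℕ
totalSlack b []       = 0
totalSlack b (c ∷ cs) = slack b c + totalSlack b cs

-- Search-tree order.  Lower bound  nothing = -∞ , upper bound  nothing = +∞.
-- Keys k of a subtree with bounds (lo , hi) satisfy lo < k ≤ hi.
AboveLo : Maybe ℕ → ℕ → Set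
AboveLo nothing  k = ⊤
AboveLo (just l) k = l < k

BelowHi : Maybe ℕ → ℕ → Set
BelowHi nothing  k = ⊤
BelowHi (just h) k = k ≤ h

InRange : Maybe ℕ → Maybe ℕ → ℕ → Set
InRange lo hi k = AboveLo lo k × BelowHi hi k

data Increasing : List ℕ → Set where
  inc-[] : Increasing []
  inc-[x] : ∀ {x} → Increasing (x ∷ [])
  inc-∷ : ∀ {x y ys} → x < y → Increasing (y ∷ ys) → Increasing (x ∷ y ∷ ys)

mutual
  SearchOK : Maybe ℕ → Maybe ℕ → Tree → Set
  SearchOK lo hi (leaf ks)    = Increasing ks × All (InRange lo hi) ks
  SearchOK lo hi (node rs cs) =
    Increasing rs × All (InRange lo hi) rs × SearchKids lo rs cs hi

  -- child i covers the range (r_{i-1} , r_i]; there is one more child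
  -- than routing keys
  SearchKids : Maybe ℕ → List ℕ → List Tree → Maybe ℕ → Set
  SearchKids lo []       []            hi = ⊥
  SearchKids lo []       (c ∷ [])      hi = SearchOK lo hi c
  SearchKids lo []       (c ∷ _ ∷ _)   hi = ⊥
  SearchKids lo (r ∷ rs) []            hi = ⊥
  SearchKids lo (r ∷ rs) (c ∷ cs)      hi =
    SearchOK lo (just r) c × SearchKids (just r) rs cs hi

IsSearchTree : Tree → Set
IsSearchTree t = SearchOK nothing nothing t

mutual
  LeavesAtDepth : ℕ → Tree → Set
  LeavesAtDepth zero    (leaf _)    = ⊤
  LeavesAtDepth (suc d) (leaf _)    = ⊥
  LeavesAtDepth zero    (node _ _)  = ⊥
  LeavesAtDepth (suc d) (node _ cs) = AllAtDepth d cs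

  AllAtDepth : ℕ → List Tree → Set
  AllAtDepth d []       = ⊤
  AllAtDepth d (c ∷ cs) = LeavesAtDepth d c × AllAtDepth d cs

mutual
  NodesOK : ℕ → Tree → Set
  NodesOK b (leaf ks)    = length ks ≤ b
  NodesOK b (node _ cs)  =
    (2 ≤ length cs) × (length cs ≤ b) × (totalSlack b cs ≤ b ∸ 1) × AllNodesOK b cs

  AllNodesOK : ℕ → List Tree → Set
  AllNodesOK b []       = ⊤
  AllNodesOK b (c ∷ cs) = NodesOK b c × AllNodesOK b cs

record IsBSlackTree (b : ℕ) (t : Tree) : Set where
  field
    searchTree : IsSearchTree t
    height     : ℕ
    sameDepth  : LeavesAtDepth height t
    nodesOK    : NodesOK b t

data _∈ᵀ_ : Tree → List Tree → Set where
  hd : ∀ {c cs} → c ∈ᵀ (c ∷ cs)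
  tl : ∀ {c d cs} → c ∈ᵀ cs → c ∈ᵀ (d ∷ cs)

data _⊑_ : Tree → Tree → Set where
  here  : ∀ {t} → t ⊑ t
  there : ∀ {u rs cs c} → u ⊑ c → c ∈ᵀ cs → u ⊑ node rs cs

-- Two children of degree at most 2 already contain 2(b − 2) ≥ b units of
-- slack once b ≥ 4, and every internal node of a B-slack tree has at least
-- two children.
module Submission where

open import Defs
open import Data.Nat using (ℕ; _<_; _≤_; _+_; _∸_; _≤?_; s≤s)
open import Data.Nat.Properties
open import Data.List using (List; []; _∷_; length)
open import Data.List.Relation.Unary.Any using (Any; here; there)
open import Data.Product using (_,_; proj₁)
open import Relation.Nullary using (yes; no)
open import Relation.Nullary.Negation using (contradiction)

∈ᵀ-AllNodesOK : ∀ {b c cs} → AllNodesOK b cs → c ∈ᵀ cs → NodesOK b c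
∈ᵀ-AllNodesOK (ok , _)   hd     = ok
∈ᵀ-AllNodesOK (_  , oks) (tl m) = ∈ᵀ-AllNodesOK oks m

⊑-NodesOK : ∀ {b u t} → NodesOK b t → u ⊑ t → NodesOK b u
⊑-NodesOK ok                here        = ok
⊑-NodesOK (_ , _ , _ , oks) (there s m) = ⊑-NodesOK (∈ᵀ-AllNodesOK oks m) s

b∸2≤slack : ∀ b t → degree t ≤ 2 → b ∸ 2 ≤ slack b t
b∸2≤slack b t = ∸-monoʳ-≤ b

b≤[b∸2]+[b∸2] : ∀ b → 4 ≤ b → b ≤ (b ∸ 2) + (b ∸ 2)
b≤[b∸2]+[b∸2] b 4≤b = begin
  b                 ≡⟨ m∸n+n≡m (≤-trans (m≤m+n 2 2) 4≤b) ⟨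
  (b ∸ 2) + 2       ≤⟨ +-monoʳ-≤ (b ∸ 2) (∸-monoˡ-≤ 2 4≤b) ⟩
  (b ∸ 2) + (b ∸ 2) ∎
  where open ≤-Reasoning

slack-two≤totalSlack : ∀ b c₁ c₂ cs → slack b c₁ + slack b c₂ ≤ totalSlack b (c₁ ∷ c₂ ∷ cs)
slack-two≤totalSlack b c₁ c₂ cs = +-monoʳ-≤ (slack b c₁) (m≤m+n (slack b c₂) (totalSlack b cs))

some-child-of-degree≥3 : ∀ b → 4 ≤ b → (cs : List Tree) → 2 ≤ length cs →
  totalSlack b cs < b → Any (λ c → 3 ≤ degree c) cs
some-child-of-degree≥3 b 4≤b (_ ∷ []) (s≤s ()) _
some-child-of-degree≥3 b 4≤b (c₁ ∷ c₂ ∷ cs) _ small with 3 ≤? degree c₁ | 3 ≤? degree c₂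
... | yes big₁ | _        = here big₁
... | no  _    | yes big₂ = there (here big₂)
... | no  sm₁  | no  sm₂  = contradiction small (≤⇒≯ (begin
  b                         ≤⟨ b≤[b∸2]+[b∸2] b 4≤b ⟩
  (b ∸ 2) + (b ∸ 2)         ≤⟨ +-mono-≤ (b∸2≤slack b c₁ (≤-pred (≰⇒> sm₁)))
                                        (b∸2≤slack b c₂ (≤-pred (≰⇒> sm₂))) ⟩
  slack b c₁ + slack b c₂   ≤⟨ slack-two≤totalSlack b c₁ c₂ cs ⟩
  totalSlack b (c₁ ∷ c₂ ∷ cs) ∎))
  where open ≤-Reasoning

proposition15 : (b : ℕ) → 4 < b → (t : Tree) → IsBSlackTree b t →
    (rs : List ℕ) (cs : List Tree) → node rs cs ⊑ t →
    totalSlack b cs < b →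
    Any (λ c → 3 ≤ degree c) cs
proposition15 b 4<b t isBSlack rs cs u⊑t small =
  some-child-of-degree≥3 b (<⇒≤ 4<b) cs two≤children small
  where
  two≤children : 2 ≤ length cs
  two≤children = proj₁ (⊑-NodesOK (IsBSlackTree.nodesOK isBSlack) u⊑t)
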